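{- Let $d$ be a prime number, let $K=\mathbb{Q}(\sqrt{d})$ with ring of integers $\mathcal{O}_K=\mathbb{Z}[\omega]$, where $\omega=\sqrt{d}$ if $d\equiv 2,3\mod 4$ and $\omega=\frac{1+\sqrt{d}}{2}$ if $d\equiv 1\mod 4$. Let $\varepsilon>1$ be the fundamental unit of $\mathcal{O}_K$ and let $x,y\in\mathbb{N}_0$ be the unique nonnegative integers with $\varepsilon=x+y\omega$. Let $\mathcal{O}_d=\mathbb{Z}+d\mathcal{O}_K$. If $\eta$ is a unit of $\mathcal{O}_d$ with $1<\eta<\varepsilon^d$ (as real numbers, viewing $K\subseteq\mathbb{R}$), then $d\mid y$.
   Context: The fundamental unit $\varepsilon>1$ of $\mathcal{O}_K$ is the element with $\varepsilon>1$ such that the unit group of $\mathcal{O}_K$ is $\{\pm\varepsilon^k:k\in\mathbb{Z}\}$. For $f\in\mathbb{N}$, $\mathcal{O}_f=\mathbb{Z}+f\mathcal{O}_K$ is the order in $K$ of conductor $f$; $\mathcal{O}_d^{\times}$ denotes its unit group. -}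

module Defs where

open import Data.Bool using (Bool; if_then_else_)
open import Data.Nat as ℕ using (ℕ; zero; suc)
open import Data.Nat.DivMod using (_%_; _/_)
open import Data.Integer using (ℤ; +_; _+_; _*_; -_; _-_; _≤_; _<_; 0ℤ; 1ℤ)
open import Data.Integer.Divisibility using (_∣_)
open import Data.Product using (_×_; _,_; ∃; proj₁; proj₂)
open import Data.Sum using (_⊎_)
open import Relation.Binary.PropositionalEquality using (_≡_)

isOne4 : ℕ → Bool
isOne4 d = (d % 4) ℕ.≡ᵇ 1

-- ω satisfies ω² = tr d · ω + nm d
--   d ≡ 2,3 mod 4 : ω = √d,          ω² = d
--   d ≡ 1   mod 4 : ω = (1+√d)/2,    ω² = ω + (d-1)/4
tr : ℕ → ℤ
tr d = if isOne4 d then 1ℤ else 0ℤ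

nm : ℕ → ℤ
nm d = if isOne4 d then + ((d ℕ.∸ 1) / 4) else + d

-- An element of O_K = ℤ[ω] is a pair (a , b) standing for a + b ω.
OK : Set
OK = ℤ × ℤ

oneK : OK
oneK = (1ℤ , 0ℤ)

negK : OK → OK
negK (a , b) = (- a , - b)

subK : OK → OK → OK
subK (a , b) (c , e) = (a - c , b - e)

mulK : ℕ → OK → OK → OK
mulK d (a , b) (c , e) = (a * c + b * e * nm d , a * e + b * c + b * e * tr d)

powK : ℕ → OK → ℕ → OK
powK d u zero = oneK
powK d u (suc k) = mulK d u (powK d u k)

-- 2(a + bω) = A + B√d
twiceK : ℕ → OK → ℤ × ℤ
twiceK d (a , b) = if isOne4 d then (a + a + b , b) else (a + a , b + b)

-- A + B√d > 0 as a real number (d a non-square positive integer)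
PosSqrt : ℕ → ℤ × ℤ → Set
PosSqrt d (A , B) =
  (0ℤ ≤ A × 0ℤ ≤ B × (0ℤ < A ⊎ 0ℤ < B))
  ⊎ (0ℤ < A × B < 0ℤ × + d * B * B < A * A)
  ⊎ (A < 0ℤ × 0ℤ < B × A * A < + d * B * B)

-- u < v as real numbers, via the real embedding K ⊆ ℝ with √d > 0
_<[_]_ : OK → ℕ → OK → Set
u <[ d ] v = PosSqrt d (twiceK d (subK v u))

IsUnitK : ℕ → OK → Set
IsUnitK d u = ∃ λ v → mulK d u v ≡ oneK

-- ε is the fundamental unit: ε > 1, and the unit group is {±ε^k : k ∈ ℤ}
-- (ε^{-k} written as the element w with w · ε^k = 1)
IsFundamentalUnit : ℕ → OK → Set
IsFundamentalUnit d ε =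
  IsUnitK d ε × (oneK <[ d ] ε) ×
  (∀ u → IsUnitK d u → ∃ λ (k : ℕ) →
      (u ≡ powK d ε k) ⊎ (u ≡ negK (powK d ε k))
      ⊎ (mulK d u (powK d ε k) ≡ oneK) ⊎ (mulK d u (powK d ε k) ≡ negK oneK))

-- O_d = ℤ + d O_K = { a + bω : d ∣ b }
InOd : ℕ → OK → Set
InOd d (a , b) = + d ∣ b

IsUnitOd : ℕ → OK → Set
IsUnitOd d η = InOd d η × ∃ λ v → InOd d v × mulK d η v ≡ oneK

module Submission where

-- Write c·(a + bω) = A + B√d with c ∈ {1, 2}, and c·ε = S + y√d. A unit η > 1 is ε^k (the units are
-- ±ε^ℤ, and the other three shapes have a negative coordinate or vanishing √d-part). The coordinates
-- of ε^k are positive and, from k = 1 on, nondecreasing in k: |S² − d y²| = c² puts (S, y) in the cone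
-- y ≤ S ≤ d y, which multiplication by ε preserves. So η < ε^d forces 0 < k < d. Expanding
-- (S + y√d)^k, the √d-part B_k of c·ε^k satisfies S·c^k·B_k ≡ k·c·S^k·y (mod d). Now d ∣ B_k since
-- η ∈ O_d, while d ∤ k, d ∤ c and d ∤ S (as S² − d y² = ±c²); hence d ∣ y.

open import Defs
open import Data.Nat using (ℕ)
open import Data.Nat.Primality using (Prime)
open import Data.Integer using (ℤ; +_)
open import Data.Integer.Divisibility using (_∣_)
open import Data.Product using (_,_)

open import Data.Bool using (true; false; T; if_then_else_)
open import Data.Empty using (⊥-elim)
open import Data.Integer as ℤ
  using (_+_; _*_; _-_; -_; _^_; _≤_; _<_; 0ℤ; 1ℤ; -1ℤ; ∣_∣; +<+; +≤+; nonNegative)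
import Data.Integer.Divisibility.Signed as Signed
import Data.Integer.Properties as ℤP
open import Data.Integer.Tactic.RingSolver using (solve-∀; solve)
open import Data.List using (_∷_; [])
open import Data.Nat as ℕ using (zero; suc; z≤n; s≤s)
open import Data.Nat.DivMod using (_%_; _/_; m≡m%n+[m/n]*n; m*n/n≡m)
import Data.Nat.Divisibility as ℕD
import Data.Nat.Properties as ℕP
open import Data.Nat.Primality using (¬prime[1]; euclidsLemma; prime⇒nonTrivial)
open import Data.Product using (_×_; proj₁; proj₂; map₂; zip′)
open import Data.Sum as Sum using (_⊎_; inj₁; inj₂; [_,_]′)
open import Data.Unit using (tt)
open import Function using (_∘_; id)
open import Relation.Binary.PropositionalEquality
open import Relation.Nullary using (¬_)

0≤* : ∀ {i j} → 0ℤ ≤ i → 0ℤ ≤ j → 0ℤ ≤ i * j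
0≤* {i} 0≤i 0≤j = subst (_≤ i * _) (ℤP.*-zeroʳ i) (ℤP.*-monoˡ-≤-nonNeg i {{nonNegative 0≤i}} 0≤j)

0<* : ∀ {i j} → 0ℤ < i → 0ℤ < j → 0ℤ < i * j
0<* {i} 0<i 0<j = subst (_< i * _) (ℤP.*-zeroʳ i) (ℤP.*-monoˡ-<-pos i {{ℤ.positive 0<i}} 0<j)

*-cancelˡ-0≤ : ∀ {c i} → 0ℤ < c → 0ℤ ≤ c * i → 0ℤ ≤ i
*-cancelˡ-0≤ {c} {i} 0<c =
  ℤP.*-cancelˡ-≤-pos 0ℤ i c {{ℤ.positive 0<c}} ∘ subst (_≤ c * i) (sym (ℤP.*-zeroʳ c))

*-cancelˡ-0< : ∀ {c i} → 0ℤ < c → 0ℤ < c * i → 0ℤ < i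
*-cancelˡ-0< {c} 0<c =
  ℤP.*-cancelˡ-<-nonNeg c {{nonNegative (ℤP.<⇒≤ 0<c)}} ∘ subst (_< c * _) (sym (ℤP.*-zeroʳ c))

*-cancelˡ-<0 : ∀ {c i} → 0ℤ < c → c * i < 0ℤ → i < 0ℤ
*-cancelˡ-<0 {c} 0<c =
  ℤP.*-cancelˡ-<-nonNeg c {{nonNegative (ℤP.<⇒≤ 0<c)}} ∘ subst (c * _ <_) (sym (ℤP.*-zeroʳ c))

*²-cancelˡ-< : ∀ {m i j} → 0ℤ < m → m * m * i < m * m * j → i < j
*²-cancelˡ-< {m} 0<m = ℤP.*-cancelˡ-<-nonNeg (m * m) {{nonNegative (0≤* (ℤP.<⇒≤ 0<m) (ℤP.<⇒≤ 0<m))}}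

square-≤ : ∀ {i j} → 0ℤ ≤ i → i ≤ j → i * i ≤ j * j
square-≤ {i} {j} 0≤i i≤j =
  ℤP.≤-trans (ℤP.*-monoˡ-≤-nonNeg i {{nonNegative 0≤i}} i≤j)
             (ℤP.*-monoʳ-≤-nonNeg j {{nonNegative (ℤP.≤-trans 0≤i i≤j)}} i≤j)

square-< : ∀ {i j} → 0ℤ ≤ i → i < j → i * i < j * j
square-< {i} {j} 0≤i i<j =
  ℤP.≤-<-trans (ℤP.*-monoˡ-≤-nonNeg i {{nonNegative 0≤i}} (ℤP.<⇒≤ i<j))
               (ℤP.*-monoʳ-<-pos j {{ℤ.positive (ℤP.≤-<-trans 0≤i i<j)}} i<j)

square-scaled : ∀ m i → m * i * (m * i) ≡ m * m * (i * i)
square-scaled = solve-∀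

D-square-scaled : ∀ D m i → D * (m * i) * (m * i) ≡ m * m * (D * i * i)
D-square-scaled = solve-∀

0<i-j⇒j<i : ∀ {i j} → 0ℤ < i - j → j < i
0<i-j⇒j<i {i} {j} 0<i-j = subst₂ _<_ (ℤP.+-identityʳ j) j+[i-j]≡i (ℤP.+-monoʳ-< j 0<i-j)
  where
  j+[i-j]≡i : j + (i - j) ≡ i
  j+[i-j]≡i = solve (i ∷ j ∷ [])

scaled-gap⇒≤ : ∀ {c i j e} → 0ℤ < c → c * (j - i) ≡ e → 0ℤ ≤ e → i ≤ j
scaled-gap⇒≤ 0<c c[j-i]≡e 0≤e = ℤP.0≤i-j⇒j≤i (*-cancelˡ-0≤ 0<c (subst (0ℤ ≤_) (sym c[j-i]≡e) 0≤e))

≡±⇒within : ∀ {X Y e} → 0ℤ ≤ e → X ≡ Y + e ⊎ X ≡ Y - e → X ≤ Y + e × Y ≤ X + e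
≡±⇒within {Y = Y} {e} 0≤e (inj₁ refl) =
    ℤP.≤-refl
  , ℤP.≤-trans (ℤP.i≤i+j Y e {{nonNegative 0≤e}}) (ℤP.i≤i+j (Y + e) e {{nonNegative 0≤e}})
≡±⇒within {Y = Y} {e} 0≤e (inj₂ refl) =
    ℤP.≤-trans (ℤP.i-j≤i Y e {{nonNegative 0≤e}}) (ℤP.i≤i+j Y e {{nonNegative 0≤e}})
  , ℤP.≤-reflexive Y≡Y-e+e
  where
  Y≡Y-e+e : Y ≡ Y - e + e
  Y≡Y-e+e = solve (Y ∷ e ∷ [])

∣i∣≡1⇒i≡±1 : ∀ {i} → ∣ i ∣ ≡ 1 → i ≡ 1ℤ ⊎ i ≡ -1ℤ
∣i∣≡1⇒i≡±1 {+ .1}         refl = inj₁ refl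
∣i∣≡1⇒i≡±1 { ℤ.-[1+ .0 ]} refl = inj₂ refl

prime∤±1 : ∀ {p i} → Prime p → i ≡ 1ℤ ⊎ i ≡ -1ℤ → ¬ (+ p ∣ i)
prime∤±1 p-prime (inj₁ refl) p∣1 = ¬prime[1] (subst Prime (ℕD.∣1⇒≡1 p∣1) p-prime)
prime∤±1 p-prime (inj₂ refl) p∣1 = ¬prime[1] (subst Prime (ℕD.∣1⇒≡1 p∣1) p-prime)

prime∣*⇒∣⊎∣ : ∀ {p} → Prime p → ∀ {i j} → + p ∣ i * j → (+ p ∣ i) ⊎ (+ p ∣ j)
prime∣*⇒∣⊎∣ {p} p-prime {i} {j} = euclidsLemma ∣ i ∣ ∣ j ∣ p-prime ∘ subst (p ℕD.∣_) (ℤP.abs-* i j)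

prime∤* : ∀ {p} → Prime p → ∀ {i j} → ¬ (+ p ∣ i) → ¬ (+ p ∣ j) → ¬ (+ p ∣ i * j)
prime∤* p-prime {i} {j} p∤i p∤j = [ p∤i , p∤j ]′ ∘ prime∣*⇒∣⊎∣ p-prime {i} {j}

prime∤^ : ∀ {p} → Prime p → ∀ {i} → ¬ (+ p ∣ i) → ∀ n → ¬ (+ p ∣ i ^ n)
prime∤^ p-prime     p∤i zero    = prime∤±1 p-prime (inj₁ refl)
prime∤^ p-prime {i} p∤i (suc n) = prime∤* p-prime {i} {i ^ n} p∤i (prime∤^ p-prime p∤i n)

0<i<p⇒p∤i : ∀ {p i} → 0ℤ < i → i < + p → ¬ (+ p ∣ i)
0<i<p⇒p∤i {i = + zero}     (+<+ ()) _
0<i<p⇒p∤i {i = ℤ.+[1+ n ]} _        (+<+ i<p) = ℕD.>⇒∤ i<p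

-- Coordinates in ℤ[√d]

-- ω = (t + √d)/c with t = tr d ∈ {0, 1} and c = 1 + t, so that c·(a + bω) = (c·a + t·b) + b·√d.
den : ℕ → ℤ
den d = 1ℤ + tr d

rational : ℕ → OK → ℤ
rational d (a , b) = den d * a + tr d * b

norm : ℕ → OK → ℤ
norm d (a , b) = a * a + tr d * a * b - nm d * b * b

0<den : ∀ d → 0ℤ < den d
0<den d with isOne4 d
... | true  = +<+ (s≤s z≤n)
... | false = +<+ (s≤s z≤n)

den≤2 : ∀ d → den d ≤ + 2
den≤2 d with isOne4 d
... | true  = ℤP.≤-refl
... | false = +≤+ (s≤s z≤n)

0<2-tr : ∀ d → 0ℤ < + 2 - tr d
0<2-tr d with isOne4 d
... | true  = +<+ (s≤s z≤n)
... | false = +<+ (s≤s z≤n)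

isOne4⇒d≡1+[d∸1]/4*4 : ∀ {d} → isOne4 d ≡ true → d ≡ 1 ℕ.+ ((d ℕ.∸ 1) / 4) ℕ.* 4
isOne4⇒d≡1+[d∸1]/4*4 {d} d≡1[4] = trans d≡1+q*4 (cong (λ m → 1 ℕ.+ m ℕ.* 4) (sym [d∸1]/4≡q))
  where
  q : ℕ
  q = d / 4
  d≡1+q*4 : d ≡ 1 ℕ.+ q ℕ.* 4
  d≡1+q*4 = trans (m≡m%n+[m/n]*n d 4) (cong (ℕ._+ q ℕ.* 4) (ℕP.≡ᵇ⇒≡ (d % 4) 1 (subst T (sym d≡1[4]) tt)))
  [d∸1]/4≡q : (d ℕ.∸ 1) / 4 ≡ q
  [d∸1]/4≡q = trans (cong (λ n → (n ℕ.∸ 1) / 4) d≡1+q*4) (m*n/n≡m q 4)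

d≡den²nm+tr : ∀ d → + d ≡ den d * den d * nm d + tr d
d≡den²nm+tr d with isOne4 d in d≡1[4]
... | false = sym (trans (ℤP.+-identityʳ (1ℤ * + d)) (ℤP.*-identityˡ (+ d)))
... | true  = begin
  + d                 ≡⟨ cong +_ (isOne4⇒d≡1+[d∸1]/4*4 d≡1[4]) ⟩
  + (1 ℕ.+ q ℕ.* 4)   ≡⟨ cong (λ m → 1ℤ + m) (ℤP.pos-* q 4) ⟩
  1ℤ + + q * + 4      ≡⟨ ℤP.+-comm 1ℤ (+ q * + 4) ⟩
  + q * + 4 + 1ℤ      ≡⟨ cong (_+ 1ℤ) (ℤP.*-comm (+ q) (+ 4)) ⟩
  + 4 * + q + 1ℤ      ∎
  where
  open ≡-Reasoning
  q : ℕ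
  q = (d ℕ.∸ 1) / 4

den²<d : ∀ {d} → Prime d → den d * den d < + d
den²<d {d} d-prime with isOne4 d in d≡1[4]
... | false = +<+ (ℕ.nonTrivial⇒n>1 d {{prime⇒nonTrivial d-prime}})
... | true  = +<+ (4<d ((d ℕ.∸ 1) / 4) (isOne4⇒d≡1+[d∸1]/4*4 d≡1[4]))
  where
  4<d : ∀ q → d ≡ 1 ℕ.+ q ℕ.* 4 → 4 ℕ.< d
  4<d zero    d≡1   = ⊥-elim (¬prime[1] (subst Prime d≡1 d-prime))
  4<d (suc q) d≡5+q = subst (4 ℕ.<_) (sym d≡5+q) (ℕP.m≤m+n 5 (q ℕ.* 4))

-- The multiplication formulas below hold only because t² = t; splitting on t lets the ring solver use it.
data Bit : ℤ → Set where
  0-bit : Bit 0ℤ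
  1-bit : Bit 1ℤ

tr-bit : ∀ d → Bit (tr d)
tr-bit d with isOne4 d
... | true  = 1-bit
... | false = 0-bit

rational-mul-identity : ∀ {t} → Bit t → ∀ n a b e f → let c = 1ℤ + t in
  c * (c * (a * e + b * f * n) + t * (a * f + b * e + b * f * t))
    ≡ (c * a + t * b) * (c * e + t * f) + (c * c * n + t) * b * f
rational-mul-identity 0-bit = solve-∀
rational-mul-identity 1-bit = solve-∀

irrational-mul-identity : ∀ {t} → Bit t → ∀ a b e f → let c = 1ℤ + t in
  c * (a * f + b * e + b * f * t) ≡ (c * a + t * b) * f + b * (c * e + t * f)
irrational-mul-identity 0-bit = solve-∀
irrational-mul-identity 1-bit = solve-∀

rational²-identity : ∀ {t} → Bit t → ∀ n a b → let c = 1ℤ + t in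
  (c * a + t * b) * (c * a + t * b) ≡ (c * c * n + t) * b * b + c * c * (a * a + t * a * b - n * b * b)
rational²-identity 0-bit = solve-∀
rational²-identity 1-bit = solve-∀

rational-mul : ∀ d u v →
  den d * rational d (mulK d u v) ≡ rational d u * rational d v + + d * proj₂ u * proj₂ v
rational-mul d u@(a , b) v@(e , f) =
  trans (rational-mul-identity (tr-bit d) (nm d) a b e f)
        (cong (λ D → rational d u * rational d v + D * b * f) (sym (d≡den²nm+tr d)))

irrational-mul : ∀ d u v → den d * proj₂ (mulK d u v) ≡ rational d u * proj₂ v + proj₂ u * rational d v
irrational-mul d (a , b) (e , f) = irrational-mul-identity (tr-bit d) a b e f

rational² : ∀ d u → rational d u * rational d u ≡ + d * proj₂ u * proj₂ u + den d * den d * norm d u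
rational² d u@(a , b) =
  trans (rational²-identity (tr-bit d) (nm d) a b)
        (cong (λ D → D * b * b + den d * den d * norm d u) (sym (d≡den²nm+tr d)))

norm-mul : ∀ d u v → norm d (mulK d u v) ≡ norm d u * norm d v
norm-mul d (a , b) (e , f) = identity (tr d) (nm d) a b e f
  where
  identity : ∀ t n a b e f → let x = a * e + b * f * n ; y = a * f + b * e + b * f * t in
    x * x + t * x * y - n * y * y ≡ (a * a + t * a * b - n * b * b) * (e * e + t * e * f - n * f * f)
  identity = solve-∀

norm-one : ∀ d → norm d oneK ≡ 1ℤ
norm-one d = identity (tr d) (nm d)
  where
  identity : ∀ t n → 1ℤ * 1ℤ + t * 1ℤ * 0ℤ - n * 0ℤ * 0ℤ ≡ 1ℤ
  identity = solve-∀

rational-one : ∀ d → rational d oneK ≡ den d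
rational-one d = identity (den d) (tr d)
  where
  identity : ∀ c t → c * 1ℤ + t * 0ℤ ≡ c
  identity = solve-∀

rational-neg : ∀ d u → rational d (negK u) ≡ - rational d u
rational-neg d (a , b) = identity (den d) (tr d) a b
  where
  identity : ∀ c t a b → c * - a + t * - b ≡ - (c * a + t * b)
  identity = solve-∀

powK-one : ∀ d u → powK d u 1 ≡ u
powK-one d (a , b) = cong₂ _,_ (rational-part a b (nm d)) (irrational-part a b (tr d))
  where
  rational-part : ∀ a b n → a * 1ℤ + b * 0ℤ * n ≡ a
  rational-part = solve-∀
  irrational-part : ∀ a b t → a * 0ℤ + b * 1ℤ + b * 0ℤ * t ≡ b
  irrational-part = solve-∀

twiceK-sub : ∀ d a b a′ b′ → twiceK d (subK (a , b) (a′ , b′))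
               ≡ ((+ 2 - tr d) * (rational d (a , b) - rational d (a′ , b′)) , (+ 2 - tr d) * (b - b′))
twiceK-sub d = identity (isOne4 d)
  where
  identity : ∀ β a b a′ b′ → let t = if β then 1ℤ else 0ℤ ; c = 1ℤ + t in
    (if β then ((a - a′) + (a - a′) + (b - b′) , b - b′) else ((a - a′) + (a - a′) , (b - b′) + (b - b′)))
      ≡ ((+ 2 - t) * ((c * a + t * b) - (c * a′ + t * b′)) , (+ 2 - t) * (b - b′))
  identity true  a b a′ b′ = cong₂ _,_ (solve (a ∷ b ∷ a′ ∷ b′ ∷ [])) (solve (b ∷ b′ ∷ []))
  identity false a b a′ b′ = cong₂ _,_ (solve (a ∷ b ∷ a′ ∷ b′ ∷ [])) (solve (b ∷ b′ ∷ []))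

-- Units and the real order

unit⇒norm≡±1 : ∀ {d u} → IsUnitK d u → norm d u ≡ 1ℤ ⊎ norm d u ≡ -1ℤ
unit⇒norm≡±1 {d} {u} (v , uv≡1) = ∣i∣≡1⇒i≡±1 (ℕP.m*n≡1⇒m≡1 ∣ norm d u ∣ ∣ norm d v ∣ (begin
  ∣ norm d u ∣ ℕ.* ∣ norm d v ∣ ≡⟨ ℤP.abs-* (norm d u) (norm d v) ⟨
  ∣ norm d u * norm d v ∣       ≡⟨ cong ∣_∣ (norm-mul d u v) ⟨
  ∣ norm d (mulK d u v) ∣       ≡⟨ cong (∣_∣ ∘ norm d) uv≡1 ⟩
  ∣ norm d oneK ∣               ≡⟨ cong ∣_∣ (norm-one d) ⟩
  1                             ∎))
  where open ≡-Reasoning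

CloseSquares : ℤ → ℤ → ℤ → ℤ → Set
CloseSquares c D A B = A * A ≤ D * B * B + c * c × D * B * B ≤ A * A + c * c

unit⇒CloseSquares : ∀ {d u} → IsUnitK d u → CloseSquares (den d) (+ d) (rational d u) (proj₂ u)
unit⇒CloseSquares {d} {u} unit =
  ≡±⇒within (0≤* 0≤c 0≤c)
    (Sum.map (λ N≡1 → rational²≡ N≡1 (ℤP.*-identityʳ (c * c)))
             (λ N≡-1 → rational²≡ N≡-1 (i*-1≡-i (c * c)))
             (unit⇒norm≡±1 {d} {u} unit))
  where
  c : ℤ
  c = den d
  0≤c : 0ℤ ≤ c
  0≤c = ℤP.<⇒≤ (0<den d)
  rational²≡ : ∀ {N e} → norm d u ≡ N → c * c * N ≡ e →
               rational d u * rational d u ≡ + d * proj₂ u * proj₂ u + e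
  rational²≡ refl refl = rational² d u
  i*-1≡-i : ∀ i → i * -1ℤ ≡ - i
  i*-1≡-i = solve-∀

PosSqrt-cancel : ∀ {d m A B} → 0ℤ < m → PosSqrt d (m * A , m * B) → PosSqrt d (A , B)
PosSqrt-cancel 0<m (inj₁ (0≤mA , 0≤mB , 0<mA⊎0<mB)) =
  inj₁ (*-cancelˡ-0≤ 0<m 0≤mA , *-cancelˡ-0≤ 0<m 0≤mB ,
        Sum.map (*-cancelˡ-0< 0<m) (*-cancelˡ-0< 0<m) 0<mA⊎0<mB)
PosSqrt-cancel {d} {m} {A} {B} 0<m (inj₂ (inj₁ (0<mA , mB<0 , d[mB]²<[mA]²))) =
  inj₂ (inj₁ (*-cancelˡ-0< 0<m 0<mA , *-cancelˡ-<0 0<m mB<0 ,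
              *²-cancelˡ-< 0<m (subst₂ _<_ (D-square-scaled (+ d) m B) (square-scaled m A) d[mB]²<[mA]²)))
PosSqrt-cancel {d} {m} {A} {B} 0<m (inj₂ (inj₂ (mA<0 , 0<mB , [mA]²<d[mB]²))) =
  inj₂ (inj₂ (*-cancelˡ-<0 0<m mA<0 , *-cancelˡ-0< 0<m 0<mB ,
              *²-cancelˡ-< 0<m (subst₂ _<_ (square-scaled m A) (D-square-scaled (+ d) m B) [mA]²<d[mB]²)))

PosSqrt-nonPos : ∀ {d A B} → A ≤ 0ℤ → B ≤ 0ℤ → ¬ PosSqrt d (A , B)
PosSqrt-nonPos A≤0 B≤0 (inj₁ (_ , _ , inj₁ 0<A))  = ℤP.≤⇒≯ A≤0 0<A
PosSqrt-nonPos A≤0 B≤0 (inj₁ (_ , _ , inj₂ 0<B))  = ℤP.≤⇒≯ B≤0 0<B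
PosSqrt-nonPos A≤0 B≤0 (inj₂ (inj₁ (0<A , _)))     = ℤP.≤⇒≯ A≤0 0<A
PosSqrt-nonPos A≤0 B≤0 (inj₂ (inj₂ (_ , 0<B , _))) = ℤP.≤⇒≯ B≤0 0<B

<[]⇒PosSqrt : ∀ {d u v} → u <[ d ] v → PosSqrt d (rational d v - rational d u , proj₂ v - proj₂ u)
<[]⇒PosSqrt {d} {a , b} {a′ , b′} = PosSqrt-cancel {d} (0<2-tr d) ∘ subst (PosSqrt d) (twiceK-sub d a′ b′ a b)

PosSqrt-above⇒positive : ∀ {d c A B} → 0ℤ < c → CloseSquares c (+ d) A B →
                         PosSqrt d (A - c , B) → 0ℤ < A × 0ℤ < B
PosSqrt-above⇒positive {d} {c} {A} {B} 0<c (A²≤ , _) (inj₁ (0≤A-c , 0≤B , 0<A-c⊎0<B)) =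
  ℤP.<-≤-trans 0<c (ℤP.0≤i-j⇒j≤i 0≤A-c) , [ 0<B , id ]′ 0<A-c⊎0<B
  where
  open ℤP.≤-Reasoning
  0<B : 0ℤ < A - c → 0ℤ < B
  0<B 0<A-c = ℤP.≤∧≢⇒< 0≤B λ 0≡B → ℤP.<-irrefl refl (begin-strict
    c * c                  <⟨ square-< (ℤP.<⇒≤ 0<c) (0<i-j⇒j<i {A} 0<A-c) ⟩
    A * A                  ≤⟨ A²≤ ⟩
    + d * B * B + c * c    ≡⟨ cong (λ b → + d * b * b + c * c) 0≡B ⟨
    + d * 0ℤ * 0ℤ + c * c  ≡⟨ cong (_+ c * c) (ℤP.*-zeroʳ (+ d * 0ℤ)) ⟩
    0ℤ + c * c             ≡⟨ ℤP.+-identityˡ (c * c) ⟩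
    c * c                  ∎)
PosSqrt-above⇒positive {d} {c} {A} {B} 0<c (A²≤ , _) (inj₂ (inj₁ (0<A-c , _ , dB²<[A-c]²))) =
  ⊥-elim (ℤP.<-irrefl refl (begin-strict
    A * A                         ≤⟨ A²≤ ⟩
    + d * B * B + c * c           <⟨ ℤP.+-monoˡ-< (c * c) dB²<[A-c]² ⟩
    (A - c) * (A - c) + c * c     ≡⟨ solve (A ∷ c ∷ []) ⟩
    A * A - + 2 * c * (A - c)     ≤⟨ ℤP.i-j≤i (A * A) (+ 2 * c * (A - c)) {{nonNegative 0≤2c[A-c]}} ⟩
    A * A                         ∎))
  where
  open ℤP.≤-Reasoning
  0≤2c[A-c] : 0ℤ ≤ + 2 * c * (A - c)
  0≤2c[A-c] = 0≤* (0≤* {+ 2} (+≤+ z≤n) (ℤP.<⇒≤ 0<c)) (ℤP.<⇒≤ 0<A-c)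
PosSqrt-above⇒positive {d} {c} {A} {B} 0<c (_ , dB²≤) (inj₂ (inj₂ (_ , 0<B , [A-c]²<dB²))) =
  ℤP.≰⇒> A≰0 , 0<B
  where
  open ℤP.≤-Reasoning
  A≰0 : ¬ (A ≤ 0ℤ)
  A≰0 A≤0 = ℤP.<-irrefl refl (begin-strict
    + d * B * B                     ≤⟨ dB²≤ ⟩
    A * A + c * c                   ≤⟨ ℤP.i≤i+j (A * A + c * c) (+ 2 * c * - A) {{nonNegative 0≤2c[-A]}} ⟩
    A * A + c * c + + 2 * c * - A   ≡⟨ solve (A ∷ c ∷ []) ⟩
    (A - c) * (A - c)               <⟨ [A-c]²<dB² ⟩
    + d * B * B                     ∎)
    where
    0≤2c[-A] : 0ℤ ≤ + 2 * c * - A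
    0≤2c[-A] = 0≤* (0≤* {+ 2} (+≤+ z≤n) (ℤP.<⇒≤ 0<c)) (ℤP.neg-mono-≤ A≤0)

unit>1⇒positive : ∀ {d u} → IsUnitK d u → oneK <[ d ] u → 0ℤ < rational d u × 0ℤ < proj₂ u
unit>1⇒positive {d} {u} unit 1<u =
  PosSqrt-above⇒positive {d} (0<den d) (unit⇒CloseSquares {d} {u} unit)
    (subst₂ (λ r b → PosSqrt d (rational d u - r , b)) (rational-one d) (ℤP.+-identityʳ (proj₂ u))
            (<[]⇒PosSqrt {d} {oneK} {u} 1<u))

InCone : ℤ → ℤ → ℤ → Set
InCone D A B = B ≤ A × A ≤ D * B

CloseSquares⇒InCone : ∀ {c D S y} → 0ℤ < c → c * c < D → 0ℤ < S → 0ℤ < y →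
                      CloseSquares c D S y → InCone D S y
CloseSquares⇒InCone {c} {D} {S} {y} 0<c c²<D 0<S 0<y (S²≤ , Dy²≤) = y≤S , S≤Dy
  where
  open ℤP.≤-Reasoning
  0≤y : 0ℤ ≤ y
  0≤y = ℤP.<⇒≤ 0<y
  1≤y² : 1ℤ ≤ y * y
  1≤y² = square-≤ (+≤+ z≤n) (ℤP.i<j⇒suc[i]≤j 0<y)
  0≤y² : 0ℤ ≤ y * y
  0≤y² = ℤP.≤-trans (+≤+ z≤n) 1≤y²
  0≤c² : 0ℤ ≤ c * c
  0≤c² = 0≤* (ℤP.<⇒≤ 0<c) (ℤP.<⇒≤ 0<c)
  0≤D : 0ℤ ≤ D
  0≤D = ℤP.≤-trans 0≤c² (ℤP.<⇒≤ c²<D)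
  0≤Dy² : 0ℤ ≤ D * y * y
  0≤Dy² = 0≤* (0≤* 0≤D 0≤y) 0≤y
  2≤D : + 2 ≤ D
  2≤D = ℤP.i<j⇒suc[i]≤j (ℤP.≤-<-trans (square-≤ (+≤+ z≤n) (ℤP.i<j⇒suc[i]≤j 0<c)) c²<D)
  y≤S : y ≤ S
  y≤S = ℤP.≮⇒≥ λ S<y → ℤP.<-irrefl refl (begin-strict
    y * y + c * c            ≡⟨ cong (λ z → y * y + z) (ℤP.*-identityʳ (c * c)) ⟨
    y * y + c * c * 1ℤ       ≤⟨ ℤP.+-monoʳ-≤ (y * y) (ℤP.*-monoˡ-≤-nonNeg (c * c) {{nonNegative 0≤c²}} 1≤y²) ⟩
    y * y + c * c * (y * y)  ≡⟨ solve (y ∷ c ∷ []) ⟩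
    (1ℤ + c * c) * (y * y)   ≤⟨ ℤP.*-monoʳ-≤-nonNeg (y * y) {{nonNegative 0≤y²}} (ℤP.i<j⇒suc[i]≤j c²<D) ⟩
    D * (y * y)              ≡⟨ ℤP.*-assoc D y y ⟨
    D * y * y                ≤⟨ Dy²≤ ⟩
    S * S + c * c            <⟨ ℤP.+-monoˡ-< (c * c) (square-< (ℤP.<⇒≤ 0<S) S<y) ⟩
    y * y + c * c            ∎)
  D≤Dy² : D ≤ D * y * y
  D≤Dy² = begin
    D            ≡⟨ ℤP.*-identityʳ D ⟨
    D * 1ℤ       ≤⟨ ℤP.*-monoˡ-≤-nonNeg D {{nonNegative 0≤D}} 1≤y² ⟩
    D * (y * y)  ≡⟨ ℤP.*-assoc D y y ⟨
    D * y * y    ∎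
  S≤Dy : S ≤ D * y
  S≤Dy = ℤP.≮⇒≥ λ Dy<S → ℤP.<-irrefl refl (begin-strict
    D * y * (D * y)        <⟨ square-< (0≤* 0≤D 0≤y) Dy<S ⟩
    S * S                  ≤⟨ S²≤ ⟩
    D * y * y + c * c      <⟨ ℤP.+-monoʳ-< (D * y * y) c²<D ⟩
    D * y * y + D          ≤⟨ ℤP.+-monoʳ-≤ (D * y * y) D≤Dy² ⟩
    D * y * y + D * y * y  ≡⟨ solve (D ∷ y ∷ []) ⟩
    + 2 * (D * y * y)      ≤⟨ ℤP.*-monoʳ-≤-nonNeg (D * y * y) {{nonNegative 0≤Dy²}} 2≤D ⟩
    D * (D * y * y)        ≡⟨ solve (D ∷ y ∷ []) ⟩
    D * y * (D * y)        ∎)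

-- If c·ε = S + y√D and c·u = A + B√D, these equations say that c·(εu) = A′ + B′√D.
module Step {c D S y A B A′ B′ : ℤ}
  (0<c : 0ℤ < c) (c≤2 : c ≤ + 2) (0≤D : 0ℤ ≤ D) (1≤S : 1ℤ ≤ S) (1≤y : 1ℤ ≤ y)
  (A′-eq : c * A′ ≡ S * A + D * y * B) (B′-eq : c * B′ ≡ S * B + y * A) where

  open ≡-Reasoning

  0<S : 0ℤ < S
  0<S = ℤP.<-≤-trans (+<+ (s≤s z≤n)) 1≤S

  0<y : 0ℤ < y
  0<y = ℤP.<-≤-trans (+<+ (s≤s z≤n)) 1≤y

  0≤S : 0ℤ ≤ S
  0≤S = ℤP.<⇒≤ 0<S

  0≤y : 0ℤ ≤ y
  0≤y = ℤP.<⇒≤ 0<y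

  positive : 0ℤ < A → 0ℤ ≤ B → 0ℤ < A′ × 0ℤ < B′
  positive 0<A 0≤B =
      *-cancelˡ-0< 0<c (subst (0ℤ <_) (sym A′-eq) (ℤP.+-mono-<-≤ (0<* 0<S 0<A) (0≤* (0≤* 0≤D 0≤y) 0≤B)))
    , *-cancelˡ-0< 0<c (subst (0ℤ <_) (sym B′-eq) (ℤP.+-mono-≤-< (0≤* 0≤S 0≤B) (0<* 0<y 0<A)))

  cone : InCone D A B → InCone D A′ B′
  cone (B≤A , A≤DB) =
      scaled-gap⇒≤ 0<c lower (ℤP.+-mono-≤ (0≤* 0≤S 0≤A-B) (0≤* 0≤y 0≤DB-A))
    , scaled-gap⇒≤ 0<c upper (ℤP.+-mono-≤ (0≤* 0≤S 0≤DB-A) (0≤* (0≤* 0≤D 0≤y) 0≤A-B))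
    where
    0≤A-B : 0ℤ ≤ A - B
    0≤A-B = ℤP.i≤j⇒0≤j-i B≤A
    0≤DB-A : 0ℤ ≤ D * B - A
    0≤DB-A = ℤP.i≤j⇒0≤j-i A≤DB
    lower : c * (A′ - B′) ≡ S * (A - B) + y * (D * B - A)
    lower = begin
      c * (A′ - B′)                        ≡⟨ solve (c ∷ A′ ∷ B′ ∷ []) ⟩
      c * A′ - c * B′                      ≡⟨ cong₂ _-_ A′-eq B′-eq ⟩
      S * A + D * y * B - (S * B + y * A)  ≡⟨ solve (S ∷ A ∷ D ∷ y ∷ B ∷ []) ⟩
      S * (A - B) + y * (D * B - A)        ∎
    upper : c * (D * B′ - A′) ≡ S * (D * B - A) + D * y * (A - B)
    upper = begin
      c * (D * B′ - A′)                          ≡⟨ solve (c ∷ D ∷ B′ ∷ A′ ∷ []) ⟩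
      D * (c * B′) - c * A′                      ≡⟨ cong₂ (λ u v → D * u - v) B′-eq A′-eq ⟩
      D * (S * B + y * A) - (S * A + D * y * B)  ≡⟨ solve (S ∷ A ∷ D ∷ y ∷ B ∷ []) ⟩
      S * (D * B - A) + D * y * (A - B)          ∎

  grows : 0ℤ ≤ B → InCone D A B → A ≤ A′ × B ≤ B′
  grows 0≤B (B≤A , A≤DB) =
      scaled-gap⇒≤ 0<c A-gap (0≤* 0≤S-1 0≤A +⁺ 0≤* (0≤* 0≤D 0≤y-1) 0≤B +⁺ 0≤DB-A +⁺ 0≤* 0≤2-c 0≤A)
    , scaled-gap⇒≤ 0<c B-gap (0≤* 0≤S-1 0≤B +⁺ 0≤* 0≤y-1 0≤A +⁺ 0≤A-B +⁺ 0≤* 0≤2-c 0≤B)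
    where
    _+⁺_ : ∀ {i j} → 0ℤ ≤ i → 0ℤ ≤ j → 0ℤ ≤ i + j
    _+⁺_ = ℤP.+-mono-≤
    infixl 6 _+⁺_
    0≤A : 0ℤ ≤ A
    0≤A = ℤP.≤-trans 0≤B B≤A
    0≤A-B : 0ℤ ≤ A - B
    0≤A-B = ℤP.i≤j⇒0≤j-i B≤A
    0≤DB-A : 0ℤ ≤ D * B - A
    0≤DB-A = ℤP.i≤j⇒0≤j-i A≤DB
    0≤S-1 : 0ℤ ≤ S - 1ℤ
    0≤S-1 = ℤP.i≤j⇒0≤j-i 1≤S
    0≤y-1 : 0ℤ ≤ y - 1ℤ
    0≤y-1 = ℤP.i≤j⇒0≤j-i 1≤y
    0≤2-c : 0ℤ ≤ + 2 - c
    0≤2-c = ℤP.i≤j⇒0≤j-i c≤2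
    A-gap : c * (A′ - A) ≡ (S - 1ℤ) * A + D * (y - 1ℤ) * B + (D * B - A) + (+ 2 - c) * A
    A-gap = begin
      c * (A′ - A)               ≡⟨ solve (c ∷ A′ ∷ A ∷ []) ⟩
      c * A′ - c * A             ≡⟨ cong (_- c * A) A′-eq ⟩
      S * A + D * y * B - c * A  ≡⟨ solve (S ∷ A ∷ D ∷ y ∷ B ∷ c ∷ []) ⟩
      (S - 1ℤ) * A + D * (y - 1ℤ) * B + (D * B - A) + (+ 2 - c) * A ∎
    B-gap : c * (B′ - B) ≡ (S - 1ℤ) * B + (y - 1ℤ) * A + (A - B) + (+ 2 - c) * B
    B-gap = begin
      c * (B′ - B)               ≡⟨ solve (c ∷ B′ ∷ B ∷ []) ⟩
      c * B′ - c * B             ≡⟨ cong (_- c * B) B′-eq ⟩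
      S * B + y * A - c * B      ≡⟨ solve (S ∷ B ∷ y ∷ A ∷ c ∷ []) ⟩
      (S - 1ℤ) * B + (y - 1ℤ) * A + (A - B) + (+ 2 - c) * B ∎

  -- C and Sᵏ stand for c^k and S^k: one step of the binomial congruences modulo D.
  rational-congruence-step : ∀ {C Sᵏ} → D Signed.∣ C * A - c * Sᵏ →
                             D Signed.∣ c * C * A′ - c * (S * Sᵏ)
  rational-congruence-step {C} {Sᵏ} D∣ =
    subst (D Signed.∣_) (sym eq)
          (Signed.∣m∣n⇒∣m+n (Signed.∣n⇒∣m*n S D∣) (Signed.∣m⇒∣m*n (y * C * B) Signed.∣-refl))
    where
    eq : c * C * A′ - c * (S * Sᵏ) ≡ S * (C * A - c * Sᵏ) + D * (y * C * B)
    eq = begin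
      c * C * A′ - c * (S * Sᵏ)               ≡⟨ solve (c ∷ C ∷ A′ ∷ S ∷ Sᵏ ∷ []) ⟩
      C * (c * A′) - c * (S * Sᵏ)             ≡⟨ cong (λ z → C * z - c * (S * Sᵏ)) A′-eq ⟩
      C * (S * A + D * y * B) - c * (S * Sᵏ)  ≡⟨ solve (C ∷ S ∷ A ∷ D ∷ y ∷ B ∷ c ∷ Sᵏ ∷ []) ⟩
      S * (C * A - c * Sᵏ) + D * (y * C * B)  ∎

  irrational-congruence-step : ∀ {C Sᵏ K} → D Signed.∣ C * A - c * Sᵏ →
                               D Signed.∣ S * C * B - K * c * Sᵏ * y →
                               D Signed.∣ S * (c * C) * B′ - (1ℤ + K) * c * (S * Sᵏ) * y
  irrational-congruence-step {C} {Sᵏ} {K} D∣A D∣B =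
    subst (D Signed.∣_) (sym eq) (Signed.∣m∣n⇒∣m+n (Signed.∣n⇒∣m*n S D∣B) (Signed.∣n⇒∣m*n (y * S) D∣A))
    where
    eq : S * (c * C) * B′ - (1ℤ + K) * c * (S * Sᵏ) * y
           ≡ S * (S * C * B - K * c * Sᵏ * y) + y * S * (C * A - c * Sᵏ)
    eq = begin
      S * (c * C) * B′ - (1ℤ + K) * c * (S * Sᵏ) * y
        ≡⟨ solve (S ∷ c ∷ C ∷ B′ ∷ K ∷ Sᵏ ∷ y ∷ []) ⟩
      S * C * (c * B′) - (1ℤ + K) * c * (S * Sᵏ) * y
        ≡⟨ cong (λ z → S * C * z - (1ℤ + K) * c * (S * Sᵏ) * y) B′-eq ⟩
      S * C * (S * B + y * A) - (1ℤ + K) * c * (S * Sᵏ) * y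
        ≡⟨ solve (S ∷ C ∷ B ∷ y ∷ A ∷ K ∷ c ∷ Sᵏ ∷ []) ⟩
      S * (S * C * B - K * c * Sᵏ * y) + y * S * (C * A - c * Sᵏ)
        ∎

-- Powers of a unit greater than 1

module PowersOfUnit {d : ℕ} (d-prime : Prime d) {x y : ℤ}
                    (ε-unit : IsUnitK d (x , y)) (1<ε : oneK <[ d ] (x , y)) where

  ε : OK
  ε = x , y

  c S : ℤ
  c = den d
  S = rational d ε

  P Q : ℕ → ℤ
  P k = rational d (powK d ε k)
  Q k = proj₂ (powK d ε k)

  0<S×0<y : 0ℤ < S × 0ℤ < y
  0<S×0<y = unit>1⇒positive {d} {ε} ε-unit 1<ε

  module Stepₖ (k : ℕ) = Step {D = + d} (0<den d) (den≤2 d) (+≤+ z≤n)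
    (ℤP.i<j⇒suc[i]≤j (proj₁ 0<S×0<y)) (ℤP.i<j⇒suc[i]≤j (proj₂ 0<S×0<y))
    (rational-mul d ε (powK d ε k)) (irrational-mul d ε (powK d ε k))

  power-positive : ∀ k → 0ℤ < P k × 0ℤ ≤ Q k
  power-positive zero    = subst (0ℤ <_) (sym (rational-one d)) (0<den d) , ℤP.≤-refl
  power-positive (suc k) = map₂ ℤP.<⇒≤ (Stepₖ.positive k 0<Pₖ 0≤Qₖ)
    where
    0<Pₖ : 0ℤ < P k
    0<Pₖ = proj₁ (power-positive k)
    0≤Qₖ : 0ℤ ≤ Q k
    0≤Qₖ = proj₂ (power-positive k)

  power-cone : ∀ k → 1 ℕ.≤ k → InCone (+ d) (P k) (Q k)
  power-cone (suc zero)    _ =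
    subst (λ u → InCone (+ d) (rational d u) (proj₂ u)) (sym (powK-one d ε))
      (CloseSquares⇒InCone (0<den d) (den²<d d-prime) (proj₁ 0<S×0<y) (proj₂ 0<S×0<y)
                           (unit⇒CloseSquares {d} {ε} ε-unit))
  power-cone (suc (suc k)) _ = Stepₖ.cone (suc k) (power-cone (suc k) (s≤s z≤n))

  power-mono : ∀ i {j} → 1 ℕ.≤ j → P j ≤ P (i ℕ.+ j) × Q j ≤ Q (i ℕ.+ j)
  power-mono zero        _   = ℤP.≤-refl , ℤP.≤-refl
  power-mono (suc i) {j} 1≤j = zip′ ℤP.≤-trans ℤP.≤-trans (power-mono i 1≤j)
    (Stepₖ.grows (i ℕ.+ j) (proj₂ (power-positive (i ℕ.+ j))) (power-cone (i ℕ.+ j) 1≤i+j))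
    where
    1≤i+j : 1 ℕ.≤ i ℕ.+ j
    1≤i+j = ℕP.≤-trans 1≤j (ℕP.m≤n+m j i)

  power<ε^d⇒<d : ∀ {k} → powK d ε k <[ d ] powK d ε d → k ℕ.< d
  power<ε^d⇒<d {k} εᵏ<εᵈ = ℕP.≰⇒> λ d≤k →
    let Pd≤Pk , Qd≤Qk = subst (λ j → P d ≤ P j × Q d ≤ Q j) (ℕP.m∸n+n≡m d≤k) (power-mono (k ℕ.∸ d) 1≤d)
    in PosSqrt-nonPos {d} (ℤP.i≤j⇒i-j≤0 Pd≤Pk) (ℤP.i≤j⇒i-j≤0 Qd≤Qk)
                      (<[]⇒PosSqrt {d} {powK d ε k} {powK d ε d} εᵏ<εᵈ)
    where
    1≤d : 1 ℕ.≤ d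
    1≤d = ℕP.<⇒≤ (ℕ.nonTrivial⇒n>1 d {{prime⇒nonTrivial d-prime}})

  rational-congruence : ∀ k → + d Signed.∣ c ^ k * P k - c * S ^ k
  rational-congruence zero    = subst (+ d Signed.∣_) (sym (identity c (tr d))) (Signed.divides 0ℤ refl)
    where
    identity : ∀ c t → 1ℤ * (c * 1ℤ + t * 0ℤ) - c * 1ℤ ≡ 0ℤ
    identity = solve-∀
  rational-congruence (suc k) = Stepₖ.rational-congruence-step k {c ^ k} {S ^ k} (rational-congruence k)

  irrational-congruence : ∀ k → + d Signed.∣ S * c ^ k * Q k - + k * c * S ^ k * y
  irrational-congruence zero    = subst (+ d Signed.∣_) (sym (identity S c y)) (Signed.divides 0ℤ refl)
    where
    identity : ∀ S c y → S * 1ℤ * 0ℤ - 0ℤ * c * 1ℤ * y ≡ 0ℤ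
    identity = solve-∀
  irrational-congruence (suc k) =
    Stepₖ.irrational-congruence-step k {c ^ k} {S ^ k} {+ k} (rational-congruence k) (irrational-congruence k)

  d∤c : ¬ (+ d ∣ c)
  d∤c = 0<i<p⇒p∤i (0<den d) (ℤP.≤-<-trans c≤c² (den²<d d-prime))
    where
    c≤c² : c ≤ c * c
    c≤c² = subst (_≤ c * c) (ℤP.*-identityʳ c)
                 (ℤP.*-monoˡ-≤-nonNeg c {{nonNegative (ℤP.<⇒≤ (0<den d))}} (ℤP.i<j⇒suc[i]≤j (0<den d)))

  d∤S : ¬ (+ d ∣ S)
  d∤S d∣S = prime∤* d-prime {c * c} {norm d ε} (prime∤* d-prime {c} {c} d∤c d∤c)
                    (prime∤±1 d-prime (unit⇒norm≡±1 {d} {ε} ε-unit)) (Signed.∣⇒∣ᵤ d∣c²N)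
    where
    d∣c²N : + d Signed.∣ c * c * norm d ε
    d∣c²N = Signed.∣m+n∣m⇒∣n
      (subst (+ d Signed.∣_) (rational² d ε) (Signed.∣m⇒∣m*n S (Signed.∣ᵤ⇒∣ {+ d} {S} d∣S)))
      (Signed.∣m⇒∣m*n y (Signed.∣m⇒∣m*n y Signed.∣-refl))

  power∈Od⇒d∣y : ∀ {k} → 0 ℕ.< k → k ℕ.< d → InOd d (powK d ε k) → + d ∣ y
  power∈Od⇒d∣y {k} 0<k k<d d∣Qₖ =
    [ ⊥-elim ∘ d∤kcSᵏ , id ]′ (prime∣*⇒∣⊎∣ d-prime {+ k * c * S ^ k} {y} (Signed.∣⇒∣ᵤ d∣kcSᵏy))
    where
    d∤kcSᵏ : ¬ (+ d ∣ + k * c * S ^ k)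
    d∤kcSᵏ = prime∤* d-prime {+ k * c} (prime∤* d-prime {+ k} (0<i<p⇒p∤i (+<+ 0<k) (+<+ k<d)) d∤c)
                     (prime∤^ d-prime d∤S k)
    d∣kcSᵏy : + d Signed.∣ + k * c * S ^ k * y
    d∣kcSᵏy = subst (+ d Signed.∣_) (ℤP.neg-involutive _)
      (Signed.∣m⇒∣-m (Signed.∣m+n∣m⇒∣n (irrational-congruence k)
                                       (Signed.∣n⇒∣m*n (S * c ^ k) (Signed.∣ᵤ⇒∣ {+ d} {Q k} d∣Qₖ))))

  above-one⇒power : ∀ {η} k → 0ℤ < rational d η → 0ℤ < proj₂ η →
    (η ≡ powK d ε k) ⊎ (η ≡ negK (powK d ε k)) ⊎
    (mulK d η (powK d ε k) ≡ oneK) ⊎ (mulK d η (powK d ε k) ≡ negK oneK) →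
    0 ℕ.< k × η ≡ powK d ε k
  above-one⇒power zero    _ (+<+ ()) (inj₁ refl)
  above-one⇒power (suc k) _ _        (inj₁ η≡εᵏ) = s≤s z≤n , η≡εᵏ
  above-one⇒power k 0<Pη _ (inj₂ (inj₁ refl)) =
    ⊥-elim (ℤP.<-asym (ℤP.neg-mono-< (proj₁ (power-positive k)))
                      (subst (0ℤ <_) (rational-neg d (powK d ε k)) 0<Pη))
  above-one⇒power {η} k 0<Pη 0<Qη (inj₂ (inj₂ ηεᵏ≡±1)) =
    ⊥-elim (ℤP.<-irrefl (sym (ℤP.*-zeroʳ c)) (subst (λ b → 0ℤ < c * b) Q[ηεᵏ]≡0 0<cQ[ηεᵏ]))
    where
    Q[ηεᵏ]≡0 : proj₂ (mulK d η (powK d ε k)) ≡ 0ℤ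
    Q[ηεᵏ]≡0 = [ cong proj₂ , cong proj₂ ]′ ηεᵏ≡±1
    0<cQ[ηεᵏ] : 0ℤ < c * proj₂ (mulK d η (powK d ε k))
    0<cQ[ηεᵏ] = subst (0ℤ <_) (sym (irrational-mul d η (powK d ε k)))
      (ℤP.+-mono-≤-< (0≤* (ℤP.<⇒≤ 0<Pη) (proj₂ (power-positive k))) (0<* 0<Qη (proj₁ (power-positive k))))

lemma2p2 : (d : ℕ) → Prime d → (x y : ℤ) → IsFundamentalUnit d (x , y)
    → (η : OK) → IsUnitOd d η → oneK <[ d ] η → η <[ d ] powK d (x , y) d
    → + d ∣ y
lemma2p2 d d-prime x y (ε-unit , 1<ε , classify) η (η∈Od , w , _ , ηw≡1) 1<η η<εᵈ =
  let k , shape      = classify η (w , ηw≡1)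
      0<Pη , 0<Qη    = unit>1⇒positive {d} {η} (w , ηw≡1) 1<η
      0<k , η≡εᵏ     = above-one⇒power k 0<Pη 0<Qη shape
  in power∈Od⇒d∣y 0<k (power<ε^d⇒<d (subst (_<[ d ] powK d (x , y) d) η≡εᵏ η<εᵈ))
                  (subst (InOd d) η≡εᵏ η∈Od)
  where open PowersOfUnit d-prime {x} {y} ε-unit 1<ε
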